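{- Let $\psi$ be a morphism in class $\mathcal{A}_2$ and let $v\in\{0,1\}^*$ be such that $\Theta(v)$ is an antipalindrome. Then $\psi(\Theta(v))$ is an antipalindrome.
   Context: $\mathbb{N}=\{0,1,2,\dots\}$. $\mathrm{R}(w_1\cdots w_n)=w_n\cdots w_1$; $\mathrm{E}(w_1\cdots w_n)=(1-w_n)\cdots(1-w_1)$; $w$ is an antipalindrome if $\mathrm{E}(w)=w$. $\Theta(0)=01$, $\Theta(1)=10$. A morphism $\psi$ on $\{0,1\}^*$ is in class $\mathcal{A}_2$ if there exist a nonempty word $\mathfrak{w}$ and $k,h\in\mathbb{N}$ with $\psi(0)=\Theta(\mathfrak{w}(\mathrm{R}(\mathfrak{w})\mathfrak{w})^k)$ and $\psi(1)=\Theta((\mathrm{R}(\mathfrak{w})\mathfrak{w})^h\mathrm{R}(\mathfrak{w}))$. -}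

module Defs where

open import Data.Bool using (Bool; true; false; not)
open import Data.List using (List; []; _∷_; _++_; reverse; map; concatMap)
open import Data.Nat using (ℕ; zero; suc)
open import Data.Product using (Σ; _×_; ∃-syntax; _,_)
open import Relation.Binary.PropositionalEquality using (_≡_)

-- Binary alphabet {0,1}: letter 0 is false, letter 1 is true.
Word : Set
Word = List Bool

R : Word → Word
R = reverse

E : Word → Word
E w = reverse (map not w)

IsAntipalindrome : Word → Set
IsAntipalindrome w = E w ≡ w

pow : Word → ℕ → Word
pow w zero    = []
pow w (suc k) = w ++ pow w k

θ : Bool → Word
θ false = false ∷ true ∷ []
θ true  = true ∷ false ∷ []

Θ : Word → Word
Θ = concatMap θ

-- A morphism on {0,1}* is determined by the images of the two letters.
Morphism : Set
Morphism = Bool → Word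

apply : Morphism → Word → Word
apply ψ = concatMap ψ

NonEmpty : Word → Set
NonEmpty w = Σ Bool λ a → Σ Word λ u → w ≡ a ∷ u

InA₂ : Morphism → Set
InA₂ ψ = ∃[ 𝔴 ] ∃[ k ] ∃[ h ]
  (NonEmpty 𝔴 ×
   ψ false ≡ Θ (𝔴 ++ pow (R 𝔴 ++ 𝔴) k) ×
   ψ true  ≡ Θ (pow (R 𝔴 ++ 𝔴) h ++ R 𝔴))

module Submission where

-- Write P = R(𝔴)𝔴, x = 𝔴 P^k and y = P^h R(𝔴), so that
-- ψ(0) = Θ(x) and ψ(1) = Θ(y).  Then ψ ∘ Θ = Θ ∘ φ for the morphism
-- φ(0) = xy, φ(1) = yx.  Both images of φ are palindromes:
-- xy = 𝔴 P^(k+h) R(𝔴) is a mirrored word around a palindrome, and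
-- yx = P^(h+1+k) is a power of the palindrome P.
--
-- Applied to
-- g = E, f = Θ this gives E ∘ Θ = Θ ∘ R; applied to g = R, f = φ it gives
-- R ∘ φ = φ ∘ R.  Hence for Θ(v) antipalindromic,
--   E(ψ(Θ v)) = Θ(R(φ v)) = Θ(φ(R v)) = ψ(Θ(R v)) = ψ(E(Θ v)) = ψ(Θ v).

open import Defs
open import Data.Bool using (Bool; true; false; not)
open import Data.List using ([]; _∷_; _++_; reverse; map; [_])
open import Data.List.Properties
  using (reverse-++; concatMap-++; ++-assoc; map-++; unfold-reverse; ++-identityʳ; reverse-involutive)
open import Data.Nat using (ℕ; zero; suc; _+_)
open import Data.Product using (_,_)
open import Relation.Binary.PropositionalEquality
  using (_≡_; refl; sym; trans; cong; cong₂; subst; module ≡-Reasoning)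

open ≡-Reasoning

IsPalindrome : Word → Set
IsPalindrome u = R u ≡ u

apply-++ : (f : Morphism) (u v : Word) → apply f (u ++ v) ≡ apply f u ++ apply f v
apply-++ f = concatMap-++ f

apply-letter : (f : Morphism) (a : Bool) → apply f [ a ] ≡ f a
apply-letter f a = ++-identityʳ (f a)

apply-apply : (f g h k : Morphism) → (∀ a → apply f (g a) ≡ apply h (k a)) →
              ∀ v → apply f (apply g v) ≡ apply h (apply k v)
apply-apply f g h k agree [] = refl
apply-apply f g h k agree (a ∷ v) = begin
  apply f (g a ++ apply g v)            ≡⟨ apply-++ f (g a) (apply g v) ⟩
  apply f (g a) ++ apply f (apply g v)  ≡⟨ cong₂ _++_ (agree a) (apply-apply f g h k agree v) ⟩
  apply h (k a) ++ apply h (apply k v)  ≡⟨ apply-++ h (k a) (apply k v) ⟨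
  apply h (k a ++ apply k v)            ∎

antimorphism-apply : (g : Word → Word) → g [] ≡ [] →
                     (∀ u v → g (u ++ v) ≡ g v ++ g u) →
                     (f : Morphism) → (∀ a → g (f a) ≡ f a) →
                     ∀ v → g (apply f v) ≡ apply f (R v)
antimorphism-apply g g-[] g-++ f fixed [] = g-[]
antimorphism-apply g g-[] g-++ f fixed (a ∷ v) = begin
  g (f a ++ apply f v)          ≡⟨ g-++ (f a) (apply f v) ⟩
  g (apply f v) ++ g (f a)      ≡⟨ cong₂ _++_ (antimorphism-apply g g-[] g-++ f fixed v) (fixed a) ⟩
  apply f (R v) ++ f a          ≡⟨ cong (apply f (R v) ++_) (apply-letter f a) ⟨
  apply f (R v) ++ apply f [ a ] ≡⟨ apply-++ f (R v) [ a ] ⟨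
  apply f (R v ++ [ a ])        ≡⟨ cong (apply f) (unfold-reverse a v) ⟨
  apply f (R (a ∷ v))           ∎

E-++ : (u v : Word) → E (u ++ v) ≡ E v ++ E u
E-++ u v = trans (cong reverse (map-++ not u v)) (reverse-++ (map not u) (map not v))

E-Θ : (v : Word) → E (Θ v) ≡ Θ (R v)
E-Θ = antimorphism-apply E refl E-++ θ θ-antipalindromic
  where
  θ-antipalindromic : ∀ a → E (θ a) ≡ θ a
  θ-antipalindromic false = refl
  θ-antipalindromic true  = refl

R-apply : (f : Morphism) → (∀ a → IsPalindrome (f a)) → ∀ v → R (apply f v) ≡ apply f (R v)
R-apply = antimorphism-apply R refl reverse-++

pow-+ : (p : Word) (m n : ℕ) → pow p (m + n) ≡ pow p m ++ pow p n
pow-+ p zero    n = refl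
pow-+ p (suc m) n = trans (cong (p ++_) (pow-+ p m n)) (sym (++-assoc p (pow p m) (pow p n)))

pow-snoc : (p : Word) (n : ℕ) → pow p n ++ p ≡ p ++ pow p n
pow-snoc p zero    = sym (++-identityʳ p)
pow-snoc p (suc n) = trans (++-assoc p (pow p n) p) (cong (p ++_) (pow-snoc p n))

pow-palindrome : (p : Word) → IsPalindrome p → ∀ n → IsPalindrome (pow p n)
pow-palindrome p pal zero    = refl
pow-palindrome p pal (suc n) = begin
  R (p ++ pow p n)      ≡⟨ reverse-++ p (pow p n) ⟩
  R (pow p n) ++ R p    ≡⟨ cong₂ _++_ (pow-palindrome p pal n) pal ⟩
  pow p n ++ p          ≡⟨ pow-snoc p n ⟩
  p ++ pow p n          ∎

mirror-palindrome : (u q : Word) → IsPalindrome q → IsPalindrome (u ++ q ++ R u)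
mirror-palindrome u q pal = begin
  R (u ++ q ++ R u)         ≡⟨ reverse-++ u (q ++ R u) ⟩
  R (q ++ R u) ++ R u       ≡⟨ cong (_++ R u) (reverse-++ q (R u)) ⟩
  (R (R u) ++ R q) ++ R u   ≡⟨ cong₂ (λ s t → (s ++ t) ++ R u) (reverse-involutive u) pal ⟩
  (u ++ q) ++ R u           ≡⟨ ++-assoc u q (R u) ⟩
  u ++ q ++ R u             ∎

module ClassA₂ (𝔴 : Word) (k h : ℕ) where

  P x y : Word
  P = R 𝔴 ++ 𝔴
  x = 𝔴 ++ pow P k
  y = pow P h ++ R 𝔴

  P-palindrome : IsPalindrome P
  P-palindrome = trans (reverse-++ (R 𝔴) 𝔴) (cong (R 𝔴 ++_) (reverse-involutive 𝔴))

  xy-palindrome : IsPalindrome (x ++ y)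
  xy-palindrome = subst IsPalindrome (sym xy-shape)
    (mirror-palindrome 𝔴 (pow P (k + h)) (pow-palindrome P P-palindrome (k + h)))
    where
    xy-shape : x ++ y ≡ 𝔴 ++ pow P (k + h) ++ R 𝔴
    xy-shape = begin
      (𝔴 ++ pow P k) ++ pow P h ++ R 𝔴      ≡⟨ ++-assoc 𝔴 (pow P k) (pow P h ++ R 𝔴) ⟩
      𝔴 ++ pow P k ++ pow P h ++ R 𝔴        ≡⟨ cong (𝔴 ++_) (++-assoc (pow P k) (pow P h) (R 𝔴)) ⟨
      𝔴 ++ (pow P k ++ pow P h) ++ R 𝔴      ≡⟨ cong (λ q → 𝔴 ++ q ++ R 𝔴) (pow-+ P k h) ⟨
      𝔴 ++ pow P (k + h) ++ R 𝔴             ∎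

  yx-palindrome : IsPalindrome (y ++ x)
  yx-palindrome = subst IsPalindrome (sym yx-shape) (pow-palindrome P P-palindrome (h + suc k))
    where
    yx-shape : y ++ x ≡ pow P (h + suc k)
    yx-shape = begin
      (pow P h ++ R 𝔴) ++ 𝔴 ++ pow P k      ≡⟨ ++-assoc (pow P h) (R 𝔴) (𝔴 ++ pow P k) ⟩
      pow P h ++ R 𝔴 ++ 𝔴 ++ pow P k        ≡⟨ cong (pow P h ++_) (++-assoc (R 𝔴) 𝔴 (pow P k)) ⟨
      pow P h ++ pow P (suc k)              ≡⟨ pow-+ P h (suc k) ⟨
      pow P (h + suc k)                     ∎

  φ : Morphism
  φ false = x ++ y
  φ true  = y ++ x

  φ-palindromic : ∀ a → IsPalindrome (φ a)
  φ-palindromic false = xy-palindrome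
  φ-palindromic true  = yx-palindrome

  ψ∘Θ : (ψ : Morphism) → ψ false ≡ Θ x → ψ true ≡ Θ y →
        ∀ v → apply ψ (Θ v) ≡ Θ (apply φ v)
  ψ∘Θ ψ ψ0 ψ1 = apply-apply ψ θ θ φ on-letters
    where
    on-letters : ∀ a → apply ψ (θ a) ≡ Θ (φ a)
    on-letters false = trans (cong₂ _++_ ψ0 (trans (apply-letter ψ true) ψ1)) (sym (apply-++ θ x y))
    on-letters true  = trans (cong₂ _++_ ψ1 (trans (apply-letter ψ false) ψ0)) (sym (apply-++ θ y x))

lemma19 : (ψ : Morphism) → InA₂ ψ → (v : Word) →
    IsAntipalindrome (Θ v) → IsAntipalindrome (apply ψ (Θ v))
lemma19 ψ (𝔴 , k , h , _ , ψ0 , ψ1) v anti = begin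
    E (apply ψ (Θ v))   ≡⟨ cong E (ψ∘Θ ψ ψ0 ψ1 v) ⟩
    E (Θ (apply φ v))   ≡⟨ E-Θ (apply φ v) ⟩
    Θ (R (apply φ v))   ≡⟨ cong Θ (R-apply φ φ-palindromic v) ⟩
    Θ (apply φ (R v))   ≡⟨ ψ∘Θ ψ ψ0 ψ1 (R v) ⟨
    apply ψ (Θ (R v))   ≡⟨ cong (apply ψ) (E-Θ v) ⟨
    apply ψ (E (Θ v))   ≡⟨ cong (apply ψ) anti ⟩
    apply ψ (Θ v)       ∎
  where open ClassA₂ 𝔴 k h
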